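{- If $w$ is a binary $1$-balanced infinite word, then its $2$-binomial complexity coincides with its subword complexity: $b^2_w(n)=p_w(n)$ for all $n\in\mathbb{N}$.
   Context: For finite words $u,x$, $\binom{u}{x}$ is the number of occurrences of $x$ in $u$ as a scattered subword ($\binom{u}{\epsilon}=1$). Finite words $u,v$ are $2$-binomially equivalent if $\binom{u}{x}=\binom{v}{x}$ for all words $x$ of length at most $2$. For an infinite word $w$, $p_w(n)$ is the number of distinct factors (contiguous subwords) of length $n$ of $w$, and $b^2_w(n)$ is the number of $2$-binomial equivalence classes among these factors. A word is $1$-balanced if for any two equally long factors $u,v$ and any letter $a$, the numbers of occurrences of $a$ in $u$ and in $v$ differ by at most $1$. -}

module Defs where

open import Data.Bool using (Bool; true; false; if_then_else_)
open import Data.Bool.Properties using () renaming (_≟_ to _≟ᴮ_)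
open import Data.Nat using (ℕ; zero; suc; _+_; _≤_)
open import Data.List using (List; []; _∷_; map; upTo; length; filter)
open import Data.List.Membership.Propositional using (_∈_)
open import Data.List.Relation.Unary.All using (All)
open import Data.List.Relation.Unary.Any using (Any)
open import Data.List.Relation.Unary.AllPairs using (AllPairs)
open import Data.List.Relation.Unary.Unique.Propositional using (Unique)
open import Data.Product using (∃; _×_)
open import Relation.Binary.PropositionalEquality using (_≡_)
open import Relation.Nullary using (¬_; does)
open import Function using (_∘_)

InfWord : Set
InfWord = ℕ → Bool

factor : InfWord → ℕ → ℕ → List Bool
factor w i n = map (λ k → w (i + k)) (upTo n)

IsFactor : InfWord → ℕ → List Bool → Set
IsFactor w n u = ∃ λ i → factor w i n ≡ u

binom : List Bool → List Bool → ℕ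
binom u [] = 1
binom [] (_ ∷ _) = 0
binom (a ∷ u) (b ∷ x) = (if does (a ≟ᴮ b) then binom u x else 0) + binom u (b ∷ x)

Binom2Equiv : List Bool → List Bool → Set
Binom2Equiv u v = ∀ (x : List Bool) → length x ≤ 2 → binom u x ≡ binom v x

occ : Bool → List Bool → ℕ
occ a u = length (filter (λ b → a ≟ᴮ b) u)

OneBalanced : InfWord → Set
OneBalanced w = ∀ (n i j : ℕ) (a : Bool) →
  (occ a (factor w i n) ≤ suc (occ a (factor w j n))) ×
  (occ a (factor w j n) ≤ suc (occ a (factor w i n)))

SubwordComplexityIs : InfWord → ℕ → ℕ → Set
SubwordComplexityIs w n k = ∃ λ (fs : List (List Bool)) →
  length fs ≡ k × Unique fs × All (IsFactor w n) fs ×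
  (∀ u → IsFactor w n u → u ∈ fs)

-- b²_w(n) = k : there is a list of k factors of length n of w,
-- pairwise not 2-binomially equivalent, such that every factor of length n
-- is 2-binomially equivalent to one of them (a system of representatives
-- of the equivalence classes).
Binom2ComplexityIs : InfWord → ℕ → ℕ → Set
Binom2ComplexityIs w n k = ∃ λ (rs : List (List Bool)) →
  length rs ≡ k × AllPairs (λ u v → ¬ Binom2Equiv u v) rs × All (IsFactor w n) rs ×
  (∀ u → IsFactor w n u → Any (Binom2Equiv u) rs)

-- Two factors u, v of equal length of a 1-balanced binary word are equal as soon as
-- |u|₁ = |v|₁ and ℓ(u) = ℓ(v), where ℓ(u) = laterOcc true u counts the pairs (position, later 1) and
-- equals binom u 01 + binom u 11. Indeed, if u = 1u' and v = 0v' then |u'|₁ < |v'|₁;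
-- balance of the prefixes of u' and v' then forces every suffix of u' to contain at
-- most as many 1s as the suffix of v' of the same length, so ℓ(u) = |u'|₁ + ℓ(u') is
-- strictly smaller than ℓ(v) = |v'|₁ + ℓ(v'). Hence 2-binomial equivalence is equality
-- on factors, and a duplicate-free list of factors is the same thing as a system of
-- representatives of the 2-binomial classes.
module Submission where

open import Defs
open import Data.Bool using (Bool; true; false)
open import Data.Bool.Properties using () renaming (_≟_ to _≟ᴮ_)
open import Data.Nat using (ℕ; zero; suc; _+_; _≤_; _<_; z≤n; s≤s; s≤s⁻¹)
open import Data.Nat.Properties
open import Algebra.Properties.CommutativeSemigroup +-commutativeSemigroup using (x∙yz≈y∙xz)
open import Data.List using (List; []; _∷_; _++_; map; upTo; applyUpTo; length; filter)
open import Data.List.Properties using (map-upTo; map-∘; map-cong; filter-++; length-++)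
open import Data.List.Relation.Unary.All using (All; []; _∷_)
import Data.List.Relation.Unary.All as All
open import Data.List.Relation.Unary.Any using (Any; here; there)
import Data.List.Relation.Unary.Any as Any
open import Data.List.Relation.Unary.AllPairs using (AllPairs; []; _∷_)
import Data.List.Relation.Unary.AllPairs as AllPairs
open import Data.Product using (_×_; _,_; proj₁; proj₂; uncurry)
open import Data.Empty using (⊥-elim)
open import Relation.Binary.PropositionalEquality
open import Relation.Nullary using (¬_)

laterOcc : Bool → List Bool → ℕ
laterOcc b []      = 0
laterOcc b (_ ∷ u) = occ b u + laterOcc b u

occ-++ : ∀ a u v → occ a (u ++ v) ≡ occ a u + occ a v
occ-++ a u v = trans (cong length (filter-++ (a ≟ᴮ_) u v)) (length-++ (filter (a ≟ᴮ_) u))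

binom-[a] : ∀ a u → binom u (a ∷ []) ≡ occ a u
binom-[a] a     []          = refl
binom-[a] false (false ∷ u) = cong suc (binom-[a] false u)
binom-[a] false (true ∷ u)  = binom-[a] false u
binom-[a] true  (false ∷ u) = binom-[a] true u
binom-[a] true  (true ∷ u)  = cong suc (binom-[a] true u)

binom-[∙b] : ∀ b u → binom u (false ∷ b ∷ []) + binom u (true ∷ b ∷ []) ≡ laterOcc b u
binom-[∙b] b [] = refl
binom-[∙b] b (false ∷ u) = begin
  (binom u (b ∷ []) + binom u (false ∷ b ∷ [])) + binom u (true ∷ b ∷ [])
    ≡⟨ +-assoc (binom u (b ∷ [])) (binom u (false ∷ b ∷ [])) (binom u (true ∷ b ∷ [])) ⟩
  binom u (b ∷ []) + (binom u (false ∷ b ∷ []) + binom u (true ∷ b ∷ []))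
    ≡⟨ cong₂ _+_ (binom-[a] b u) (binom-[∙b] b u) ⟩
  occ b u + laterOcc b u ∎
  where open ≡-Reasoning
binom-[∙b] b (true ∷ u) = begin
  binom u (false ∷ b ∷ []) + (binom u (b ∷ []) + binom u (true ∷ b ∷ []))
    ≡⟨ x∙yz≈y∙xz (binom u (false ∷ b ∷ [])) (binom u (b ∷ [])) (binom u (true ∷ b ∷ [])) ⟩
  binom u (b ∷ []) + (binom u (false ∷ b ∷ []) + binom u (true ∷ b ∷ []))
    ≡⟨ cong₂ _+_ (binom-[a] b u) (binom-[∙b] b u) ⟩
  occ b u + laterOcc b u ∎
  where open ≡-Reasoning

laterOcc-tail-≡ : ∀ c a b u v → occ c u ≡ occ c v →
  laterOcc c (a ∷ u) ≡ laterOcc c (b ∷ v) → laterOcc c u ≡ laterOcc c v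
laterOcc-tail-≡ c _ _ u v occ≡ later≡ =
  +-cancelˡ-≡ (occ c u) _ _ (trans later≡ (cong (_+ laterOcc c v) (sym occ≡)))

∷-cancel : ∀ a b u v →
  (occ true u < occ true v → laterOcc true u ≤ laterOcc true v) →
  (occ true v < occ true u → laterOcc true v ≤ laterOcc true u) →
  occ true (a ∷ u) ≡ occ true (b ∷ v) → laterOcc true (a ∷ u) ≡ laterOcc true (b ∷ v) →
  a ≡ b × occ true u ≡ occ true v × laterOcc true u ≡ laterOcc true v
∷-cancel true  true  u v _ _ occ≡ later≡ = refl , occ≡′ , laterOcc-tail-≡ true true true u v occ≡′ later≡
  where
  occ≡′ : occ true u ≡ occ true v
  occ≡′ = suc-injective occ≡
∷-cancel false false u v _ _ occ≡ later≡ = refl , occ≡ , laterOcc-tail-≡ true false false u v occ≡ later≡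
∷-cancel true  false u v u<v⇒ _ occ≡ later≡ =
  ⊥-elim (<⇒≢ (+-mono-<-≤ u<v (u<v⇒ u<v)) later≡)
  where u<v = ≤-reflexive occ≡
∷-cancel false true  u v _ v<u⇒ occ≡ later≡ =
  ⊥-elim (<⇒≢ (+-mono-<-≤ v<u (v<u⇒ v<u)) (sym later≡))
  where v<u = ≤-reflexive (sym occ≡)

factor-suc : ∀ w i n → factor w i (suc n) ≡ w i ∷ factor w (suc i) n
factor-suc w i n = cong₂ _∷_ (cong w (+-identityʳ i)) (begin
  map (λ k → w (i + k)) (applyUpTo suc n)   ≡⟨ cong (map (λ k → w (i + k))) (map-upTo suc n) ⟨
  map (λ k → w (i + k)) (map suc (upTo n))  ≡⟨ map-∘ (upTo n) ⟨
  map (λ k → w (i + suc k)) (upTo n)        ≡⟨ map-cong (λ k → cong w (+-suc i k)) (upTo n) ⟩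
  factor w (suc i) n                        ∎)
  where open ≡-Reasoning

-- Offsets are written m + i so that suc m + i reduces to suc (m + i) in the inductions.
factor-+ : ∀ w i m n → factor w i (m + n) ≡ factor w i m ++ factor w (m + i) n
factor-+ w i zero    n = refl
factor-+ w i (suc m) n = begin
  factor w i (suc (m + n))                                  ≡⟨ factor-suc w i (m + n) ⟩
  w i ∷ factor w (suc i) (m + n)                            ≡⟨ cong (w i ∷_) (factor-+ w (suc i) m n) ⟩
  w i ∷ factor w (suc i) m ++ factor w (m + suc i) n        ≡⟨ cong (λ p → w i ∷ factor w (suc i) m ++ factor w p n) (+-suc m i) ⟩
  (w i ∷ factor w (suc i) m) ++ factor w (suc m + i) n      ≡⟨ cong (_++ factor w (suc m + i) n) (factor-suc w i m) ⟨
  factor w i (suc m) ++ factor w (suc m + i) n              ∎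
  where open ≡-Reasoning

ones : InfWord → ℕ → ℕ → ℕ
ones w i n = occ true (factor w i n)

laterOnes : InfWord → ℕ → ℕ → ℕ
laterOnes w i n = laterOcc true (factor w i n)

ones-+ : ∀ w i m n → ones w i (m + n) ≡ ones w i m + ones w (m + i) n
ones-+ w i m n = trans (cong (occ true) (factor-+ w i m n)) (occ-++ true (factor w i m) _)

laterOnes-suc : ∀ w i n → laterOnes w i (suc n) ≡ ones w (suc i) n + laterOnes w (suc i) n
laterOnes-suc w i n = cong (laterOcc true) (factor-suc w i n)

module _ {w : InfWord} (balanced : OneBalanced w) where

  suffix-ones-≤ : ∀ m n i j → ones w i (m + n) < ones w j (m + n) →
                  ones w (m + i) n ≤ ones w (m + j) n
  suffix-ones-≤ m n i j lt = +-cancelˡ-≤ (ones w i m) _ _ (s≤s⁻¹ (begin-strict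
    ones w i m + ones w (m + i) n  ≡⟨ ones-+ w i m n ⟨
    ones w i (m + n)               <⟨ lt ⟩
    ones w j (m + n)               ≡⟨ ones-+ w j m n ⟩
    ones w j m + ones w (m + j) n  ≤⟨ +-monoˡ-≤ _ (proj₁ (balanced m j i true)) ⟩
    suc (ones w i m) + ones w (m + j) n ∎))
    where open ≤-Reasoning

  laterOnes-≤ : ∀ n m i j → ones w i (m + n) < ones w j (m + n) →
                laterOnes w (m + i) n ≤ laterOnes w (m + j) n
  laterOnes-≤ zero    m i j lt = z≤n
  laterOnes-≤ (suc n) m i j lt = begin
    laterOnes w (m + i) (suc n)                             ≡⟨ laterOnes-suc w (m + i) n ⟩
    ones w (suc m + i) n + laterOnes w (suc m + i) n        ≤⟨ +-mono-≤ (suffix-ones-≤ (suc m) n i j lt′)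
                                                                         (laterOnes-≤ n (suc m) i j lt′) ⟩
    ones w (suc m + j) n + laterOnes w (suc m + j) n        ≡⟨ laterOnes-suc w (m + j) n ⟨
    laterOnes w (m + j) (suc n)                             ∎
    where
    open ≤-Reasoning
    lt′ : ones w i (suc m + n) < ones w j (suc m + n)
    lt′ = subst (λ k → ones w i k < ones w j k) (+-suc m n) lt

  factor-injective : ∀ n i j → ones w i n ≡ ones w j n → laterOnes w i n ≡ laterOnes w j n →
                     factor w i n ≡ factor w j n
  factor-injective zero    i j _ _ = refl
  factor-injective (suc n) i j ones≡ later≡ = begin
    factor w i (suc n)         ≡⟨ factor-suc w i n ⟩
    w i ∷ factor w (suc i) n   ≡⟨ cong₂ _∷_ (proj₁ cancelled) (uncurry (factor-injective n (suc i) (suc j)) (proj₂ cancelled)) ⟩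
    w j ∷ factor w (suc j) n   ≡⟨ factor-suc w j n ⟨
    factor w j (suc n)         ∎
    where
    open ≡-Reasoning
    unfold : (f : List Bool → ℕ) → f (factor w i (suc n)) ≡ f (factor w j (suc n)) →
             f (w i ∷ factor w (suc i) n) ≡ f (w j ∷ factor w (suc j) n)
    unfold f = subst₂ (λ u v → f u ≡ f v) (factor-suc w i n) (factor-suc w j n)
    cancelled : w i ≡ w j × ones w (suc i) n ≡ ones w (suc j) n × laterOnes w (suc i) n ≡ laterOnes w (suc j) n
    cancelled = ∷-cancel (w i) (w j) (factor w (suc i) n) (factor w (suc j) n)
                  (laterOnes-≤ n 0 (suc i) (suc j)) (laterOnes-≤ n 0 (suc j) (suc i))
                  (unfold (occ true) ones≡) (unfold (laterOcc true) later≡)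

  binom2-factor-injective : ∀ n {u v} → IsFactor w n u → IsFactor w n v → Binom2Equiv u v → u ≡ v
  binom2-factor-injective n (i , refl) (j , refl) u≈v = factor-injective n i j ones≡ laterOnes≡
    where
    open ≡-Reasoning
    u = factor w i n
    v = factor w j n
    ones≡ : occ true u ≡ occ true v
    ones≡ = begin
      occ true u           ≡⟨ binom-[a] true u ⟨
      binom u (true ∷ [])  ≡⟨ u≈v (true ∷ []) (s≤s z≤n) ⟩
      binom v (true ∷ [])  ≡⟨ binom-[a] true v ⟩
      occ true v           ∎
    laterOnes≡ : laterOcc true u ≡ laterOcc true v
    laterOnes≡ = begin
      laterOcc true u                                              ≡⟨ binom-[∙b] true u ⟨
      binom u (false ∷ true ∷ []) + binom u (true ∷ true ∷ [])     ≡⟨ cong₂ _+_ (u≈v (false ∷ true ∷ []) (s≤s (s≤s z≤n)))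
                                                                                 (u≈v (true ∷ true ∷ []) (s≤s (s≤s z≤n))) ⟩
      binom v (false ∷ true ∷ []) + binom v (true ∷ true ∷ [])     ≡⟨ binom-[∙b] true v ⟩
      laterOcc true v                                              ∎

module _ {A : Set} {P : A → Set} {_≈_ : A → A → Set}
         (≈⇒≡ : ∀ {x y} → P x → P y → x ≈ y → x ≡ y) where

  AllPairs-≢⇒≉ : ∀ {xs} → All P xs → AllPairs _≢_ xs → AllPairs (λ x y → ¬ x ≈ y) xs
  AllPairs-≢⇒≉ []         []            = []
  AllPairs-≢⇒≉ (px ∷ pxs) (x≢xs ∷ xs!) =
    All.zipWith (λ (py , x≢y) x≈y → x≢y (≈⇒≡ px py x≈y)) (pxs , x≢xs) ∷ AllPairs-≢⇒≉ pxs xs!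

  Any-≈⇒≡ : ∀ {x xs} → P x → All P xs → Any (x ≈_) xs → Any (x ≡_) xs
  Any-≈⇒≡ px (py ∷ _)   (here x≈y) = here (≈⇒≡ px py x≈y)
  Any-≈⇒≡ px (_  ∷ pys) (there x∈) = there (Any-≈⇒≡ px pys x∈)

Binom2Equiv-reflexive : ∀ {u v} → u ≡ v → Binom2Equiv u v
Binom2Equiv-reflexive refl _ _ = refl

proposition3 : (w : InfWord) → OneBalanced w →
    (n k : ℕ) → (SubwordComplexityIs w n k → Binom2ComplexityIs w n k) × (Binom2ComplexityIs w n k → SubwordComplexityIs w n k)
proposition3 w balanced n k = subword⇒binom2 , binom2⇒subword
  where
  ≈⇒≡ : ∀ {u v} → IsFactor w n u → IsFactor w n v → Binom2Equiv u v → u ≡ v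
  ≈⇒≡ = binom2-factor-injective {w} balanced n

  subword⇒binom2 : SubwordComplexityIs w n k → Binom2ComplexityIs w n k
  subword⇒binom2 (fs , length≡ , fs! , fs-factors , fs-complete) =
    fs , length≡ , AllPairs-≢⇒≉ ≈⇒≡ fs-factors fs! , fs-factors ,
    λ u u-factor → Any.map Binom2Equiv-reflexive (fs-complete u u-factor)

  binom2⇒subword : Binom2ComplexityIs w n k → SubwordComplexityIs w n k
  binom2⇒subword (rs , length≡ , rs-distinct , rs-factors , rs-complete) =
    rs , length≡ , AllPairs.map (λ u≉v u≡v → u≉v (Binom2Equiv-reflexive u≡v)) rs-distinct , rs-factors ,
    λ u u-factor → Any-≈⇒≡ ≈⇒≡ u-factor rs-factors (rs-complete u u-factor)
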